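{- Let $n>3$ with $3\nmid n$, and consider the directed circulant graph $C_n^+(1,3)$. There is exactly one primitive periodic orbit of length $n$ with walk sum $3n$.
   Context: $C_n^+(1,3)$ is the directed graph with vertex set $\{0,1,\dots,n-1\}$ (identified with $\mathbb{Z}/n\mathbb{Z}$) whose bonds are $(v,v+1 \bmod n)$ (arc $1$) and $(v,v+3\bmod n)$ (arc $3$) for every vertex $v$. A circuit of length $l\ge1$ is a sequence $v_0,\dots,v_l=v_0$ with each $(v_i,v_{i+1})$ a bond; its walk sum is the sum of the arcs of its bonds. A periodic orbit is an equivalence class of circuits under cyclic rotation (length and walk sum being those of any of its circuits); it is primitive if it is not a shorter periodic orbit repeated several times. -}

module Defs where

open import Data.Nat using (ℕ; zero; suc; _+_; _*_; _<_; _≤_)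
open import Data.Nat.DivMod using (_%_; m%n<n)
open import Data.Nat.Divisibility using (_∣_)
open import Data.Fin using (Fin; toℕ; fromℕ<)
open import Data.Product using (Σ; ∃; _×_)
open import Relation.Binary.PropositionalEquality using (_≡_)
open import Relation.Nullary using (¬_)

data Arc : Set where
  a1 a3 : Arc

arcVal : Arc → ℕ
arcVal a1 = 1
arcVal a3 = 3

addMod : ∀ {n} → Fin n → ℕ → Fin n
addMod {suc m} v a = fromℕ< (m%n<n (toℕ v + a) (suc m))

-- A circuit of length l in C_n^+(1,3): a cyclic (l-periodic, indexed by ℕ)
-- sequence of vertices v_i together with the arc of each bond (v_i, v_{i+1}).
record Circuit (n l : ℕ) : Set where
  field
    vert   : ℕ → Fin n
    arc    : ℕ → Arc
    vper   : ∀ i → vert (i + l) ≡ vert i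
    aper   : ∀ i → arc (i + l) ≡ arc i
    bond   : ∀ i → vert (suc i) ≡ addMod (vert i) (arcVal (arc i))
open Circuit public

sumTo : ℕ → (ℕ → ℕ) → ℕ
sumTo zero    f = 0
sumTo (suc k) f = sumTo k f + f k

walkSum : ∀ {n l} → Circuit n l → ℕ
walkSum {l = l} c = sumTo l (λ i → arcVal (arc c i))

-- Same periodic orbit: one circuit is a cyclic rotation of the other.
SameOrbit : ∀ {n l} → Circuit n l → Circuit n l → Set
SameOrbit c c' = ∃ λ k → ∀ i → (vert c' i ≡ vert c (i + k)) × (arc c' i ≡ arc c (i + k))

-- Primitive: not a shorter circuit (of length d, d ∣ l, d < l) repeated l/d times.
Primitive : ∀ {n l} → Circuit n l → Set
Primitive {l = l} c = ∀ d → 1 ≤ d → d < l → d ∣ l →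
  ¬ (∀ i → (vert c (i + d) ≡ vert c i) × (arc c (i + d) ≡ arc c i))

{-# OPTIONS --safe #-}
module Submission where

-- Every arc is at most 3, so a circuit of length n with walk sum 3n uses only arc 3 and visits
-- v₀ + 3i mod n. As 3 is invertible modulo n when 3 ∤ n, each such circuit is a rotation of
-- 0, 3, 6, …, which is primitive because 3d ≡ 0 (mod n) forces n ∣ d.

open import Defs
open import Data.Nat using (ℕ; zero; suc; _+_; _*_; _<_; _≤_; z≤n; s≤s; s≤s⁻¹; NonZero; >-nonZero; >-nonZero⁻¹; _%_; _/_)
open import Data.Nat.Properties
open import Data.Nat.DivMod
open import Data.Nat.Divisibility using (_∣_; divides; m%n≡0⇒n∣m; ∣⇒≤; ∣m+n∣m⇒∣n; ∣m⇒∣m*n; n∣m*n; m∣m*n)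
open import Data.Fin using (Fin; toℕ)
open import Data.Fin.Properties using (toℕ-injective; toℕ-fromℕ<; toℕ<n)
open import Data.Product using (Σ; ∃₂; _×_; _,_; proj₁; proj₂)
open import Data.Sum using (_⊎_; inj₁; inj₂)
open import Data.Empty using (⊥-elim)
open import Function using (_∘_)
open import Relation.Binary.PropositionalEquality
open import Relation.Nullary using (¬_)
open import Data.Nat.Tactic.RingSolver using (solve-∀)

+-tight : ∀ {x y a b} → x ≤ a → y ≤ b → x + y ≡ a + b → x ≡ a × y ≡ b
+-tight {x} {y} {a} {b} x≤a y≤b eq = +-cancelʳ-≡ y x a (trans eq (cong (a +_) (sym y≡b))) , y≡b
  where
  y≡b : y ≡ b
  y≡b = ≤-antisym y≤b (+-cancelˡ-≤ a b y (subst (_≤ a + y) eq (+-monoˡ-≤ y x≤a)))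

sumTo-const : ∀ {f c} k → (∀ i → f i ≡ c) → sumTo k f ≡ k * c
sumTo-const zero    f≡c = refl
sumTo-const {c = c} (suc k) f≡c = trans (cong₂ _+_ (sumTo-const k f≡c) (f≡c k)) (+-comm (k * c) c)

sumTo-≤ : ∀ {f c} k → (∀ i → f i ≤ c) → sumTo k f ≤ k * c
sumTo-≤ zero    f≤c = z≤n
sumTo-≤ {f} {c} (suc k) f≤c = subst (sumTo k f + f k ≤_) (+-comm (k * c) c) (+-mono-≤ (sumTo-≤ k f≤c) (f≤c k))

sumTo-≡-max : ∀ {f c} k → (∀ i → f i ≤ c) → sumTo k f ≡ k * c → ∀ i → i < k → f i ≡ c
sumTo-≡-max {f} {c} (suc k) f≤c eq i i<1+k = split (m≤n⇒m<n∨m≡n (s≤s⁻¹ i<1+k))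
  where
  tight : sumTo k f ≡ k * c × f k ≡ c
  tight = +-tight (sumTo-≤ k f≤c) (f≤c k) (trans eq (+-comm c (k * c)))
  split : i < k ⊎ i ≡ k → f i ≡ c
  split (inj₁ i<k) = sumTo-≡-max k f≤c (proj₁ tight) i i<k
  split (inj₂ refl) = proj₂ tight

[m%n+o]%n≡[m+o]%n : ∀ m o n .{{_ : NonZero n}} → (m % n + o) % n ≡ (m + o) % n
[m%n+o]%n≡[m+o]%n m o n = begin
  (m % n + o) % n           ≡⟨ %-distribˡ-+ (m % n) o n ⟩
  (m % n % n + o % n) % n   ≡⟨ cong (λ x → (x + o % n) % n) (m%n%n≡m%n m n) ⟩
  (m % n + o % n) % n       ≡⟨ %-distribˡ-+ m o n ⟨
  (m + o) % n               ∎
  where open ≡-Reasoning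

%-periodic : ∀ {A : Set} {f : ℕ → A} l .{{_ : NonZero l}} →
  (∀ i → f (i + l) ≡ f i) → ∀ i → f i ≡ f (i % l)
%-periodic {f = f} l per i = trans (cong f (m≡m%n+[m/n]*n i l)) (shift (i % l) (i / l))
  where
  shift : ∀ r q → f (r + q * l) ≡ f r
  shift r zero    = cong f (+-identityʳ r)
  shift r (suc q) = begin
    f (r + (l + q * l)) ≡⟨ cong f (trans (cong (r +_) (+-comm l (q * l))) (sym (+-assoc r (q * l) l))) ⟩
    f (r + q * l + l)   ≡⟨ per (r + q * l) ⟩
    f (r + q * l)       ≡⟨ shift r q ⟩
    f r                 ∎
    where open ≡-Reasoning

∣*-cancelʳ-unit : ∀ {m u k n d} → m * u ≡ 1 + k * n → n ∣ d * m → n ∣ d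
∣*-cancelʳ-unit {m} {u} {k} {n} {d} mu≡1+kn n∣dm =
  ∣m+n∣m⇒∣n (subst (n ∣_) dmu≡dkn+d (∣m⇒∣m*n u n∣dm)) (n∣m*n (d * k))
  where
  open ≡-Reasoning
  distrib : ∀ d k n → d * (1 + k * n) ≡ d * k * n + d
  distrib = solve-∀
  dmu≡dkn+d : d * m * u ≡ d * k * n + d
  dmu≡dkn+d = begin
    d * m * u         ≡⟨ *-assoc d m u ⟩
    d * (m * u)       ≡⟨ cong (d *_) mu≡1+kn ⟩
    d * (1 + k * n)   ≡⟨ distrib d k n ⟩
    d * k * n + d     ∎

3-invertible-mod : ∀ n → ¬ 3 ∣ n → ∃₂ λ u k → 3 * u ≡ 1 + k * n
3-invertible-mod n 3∤n with n % 3 | m≡m%n+[m/n]*n n 3 | m%n<n n 3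
... | 0 | n≡q*3   | _ = ⊥-elim (3∤n (divides (n / 3) n≡q*3))
... | 1 | n≡1+q*3 | _ = 2 * (n / 3) + 1 , 2 , trans (identity (n / 3)) (cong (λ x → 1 + 2 * x) (sym n≡1+q*3))
  where
  identity : ∀ q → 3 * (2 * q + 1) ≡ 1 + 2 * (1 + q * 3)
  identity = solve-∀
... | 2 | n≡2+q*3 | _ = n / 3 + 1 , 1 , trans (identity (n / 3)) (cong (λ x → 1 + 1 * x) (sym n≡2+q*3))
  where
  identity : ∀ q → 3 * (q + 1) ≡ 1 + 1 * (2 + q * 3)
  identity = solve-∀
... | suc (suc (suc _)) | _ | s≤s (s≤s (s≤s ()))

arcVal≤3 : ∀ a → arcVal a ≤ 3
arcVal≤3 a1 = s≤s z≤n
arcVal≤3 a3 = ≤-refl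

arcVal≡3⇒a3 : ∀ a → arcVal a ≡ 3 → a ≡ a3
arcVal≡3⇒a3 a3 _ = refl

walkSum≡3*l⇒arc≡a3 : ∀ {n l} .{{_ : NonZero l}} (c : Circuit n l) →
  walkSum c ≡ 3 * l → ∀ i → arc c i ≡ a3
walkSum≡3*l⇒arc≡a3 {l = l} c ws i = trans (%-periodic l (aper c) i)
  (arcVal≡3⇒a3 _ (sumTo-≡-max l (arcVal≤3 ∘ arc c) (trans ws (*-comm 3 l)) (i % l) (m%n<n i l)))

toℕ-addMod : ∀ {n} .{{_ : NonZero n}} (v : Fin n) a → toℕ (addMod v a) ≡ (toℕ v + a) % n
toℕ-addMod {suc _} v a = toℕ-fromℕ< _

toℕ-vert : ∀ {n l} .{{_ : NonZero n}} (c : Circuit n l) i →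
  toℕ (vert c i) ≡ (toℕ (vert c 0) + sumTo i (arcVal ∘ arc c)) % n
toℕ-vert {n} c zero = sym (trans (cong (_% n) (+-identityʳ (toℕ (vert c 0)))) (m<n⇒m%n≡m (toℕ<n (vert c 0))))
toℕ-vert {n} c (suc i) = begin
  toℕ (vert c (suc i))              ≡⟨ cong toℕ (bond c i) ⟩
  toℕ (addMod (vert c i) a)         ≡⟨ toℕ-addMod (vert c i) a ⟩
  (toℕ (vert c i) + a) % n          ≡⟨ cong (λ x → (x + a) % n) (toℕ-vert c i) ⟩
  ((v + s) % n + a) % n             ≡⟨ [m%n+o]%n≡[m+o]%n (v + s) a n ⟩
  (v + s + a) % n                   ≡⟨ cong (_% n) (+-assoc v s a) ⟩
  (v + (s + a)) % n                 ∎
  where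
  open ≡-Reasoning
  v = toℕ (vert c 0)
  s = sumTo i (arcVal ∘ arc c)
  a = arcVal (arc c i)

arc3Circuit : ∀ n .{{_ : NonZero n}} → Circuit n n
arc3Circuit n = record
  { vert = λ i → (i * 3) mod n
  ; arc  = λ _ → a3
  ; vper = λ i → toℕ-injective (begin
      toℕ (((i + n) * 3) mod n) ≡⟨ toℕ-fromℕ< _ ⟩
      ((i + n) * 3) % n         ≡⟨ cong (_% n) (*-distribʳ-+ 3 i n) ⟩
      (i * 3 + n * 3) % n       ≡⟨ %-remove-+ʳ (i * 3) (m∣m*n 3) ⟩
      (i * 3) % n               ≡⟨ toℕ-fromℕ< _ ⟨
      toℕ ((i * 3) mod n)       ∎)
  ; aper = λ _ → refl
  ; bond = λ i → toℕ-injective (begin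
      toℕ ((suc i * 3) mod n)          ≡⟨ toℕ-fromℕ< _ ⟩
      (3 + i * 3) % n                  ≡⟨ cong (_% n) (+-comm 3 (i * 3)) ⟩
      (i * 3 + 3) % n                  ≡⟨ [m%n+o]%n≡[m+o]%n (i * 3) 3 n ⟨
      ((i * 3) % n + 3) % n            ≡⟨ cong (λ x → (x + 3) % n) (toℕ-fromℕ< _) ⟨
      (toℕ ((i * 3) mod n) + 3) % n    ≡⟨ toℕ-addMod ((i * 3) mod n) 3 ⟨
      toℕ (addMod ((i * 3) mod n) 3)   ∎)
  }
  where open ≡-Reasoning

walkSum-arc3Circuit : ∀ n .{{_ : NonZero n}} → walkSum (arc3Circuit n) ≡ 3 * n
walkSum-arc3Circuit n = trans (sumTo-const n (λ _ → refl)) (*-comm n 3)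

module _ {u k : ℕ} (n : ℕ) .{{_ : NonZero n}} (3u≡1+kn : 3 * u ≡ 1 + k * n) where

  arc3Circuit-primitive : Primitive (arc3Circuit n)
  arc3Circuit-primitive d 1≤d d<n _ periodic = <⇒≱ d<n (∣⇒≤ {{>-nonZero 1≤d}} n∣d)
    where
    d*3%n≡0 : (d * 3) % n ≡ 0
    d*3%n≡0 = begin
      (d * 3) % n          ≡⟨ toℕ-fromℕ< _ ⟨
      toℕ ((d * 3) mod n)  ≡⟨ cong toℕ (proj₁ (periodic 0)) ⟩
      toℕ (0 mod n)        ≡⟨ toℕ-fromℕ< _ ⟩
      0 % n                ≡⟨ m<n⇒m%n≡m (>-nonZero⁻¹ n) ⟩
      0                    ∎
      where open ≡-Reasoning
    n∣d : n ∣ d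
    n∣d = ∣*-cancelʳ-unit {u = u} {k} 3u≡1+kn (m%n≡0⇒n∣m (d * 3) n d*3%n≡0)

  arc3Circuit-unique : (c : Circuit n n) → (∀ i → arc c i ≡ a3) → SameOrbit (arc3Circuit n) c
  arc3Circuit-unique c all-a3 = u * v , λ i → toℕ-injective (same-vert i) , all-a3 i
    where
    open ≡-Reasoning
    v = toℕ (vert c 0)
    expand : ∀ i u v → (i + u * v) * 3 ≡ i * 3 + 3 * u * v
    expand = solve-∀
    regroup : ∀ i v k n → i * 3 + (1 + k * n) * v ≡ v + i * 3 + k * v * n
    regroup = solve-∀
    -- Since 3u ≡ 1 (mod n), rotating by u * v turns 3i into v + 3i modulo n.
    shift : ∀ i → (i + u * v) * 3 ≡ v + i * 3 + k * v * n
    shift i = begin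
      (i + u * v) * 3           ≡⟨ expand i u v ⟩
      i * 3 + 3 * u * v         ≡⟨ cong (λ x → i * 3 + x * v) 3u≡1+kn ⟩
      i * 3 + (1 + k * n) * v   ≡⟨ regroup i v k n ⟩
      v + i * 3 + k * v * n     ∎
    same-vert : ∀ i → toℕ (vert c i) ≡ toℕ (((i + u * v) * 3) mod n)
    same-vert i = begin
      toℕ (vert c i)                         ≡⟨ toℕ-vert c i ⟩
      (v + sumTo i (arcVal ∘ arc c)) % n     ≡⟨ cong (λ s → (v + s) % n) (sumTo-const i (cong arcVal ∘ all-a3)) ⟩
      (v + i * 3) % n                        ≡⟨ [m+kn]%n≡m%n (v + i * 3) (k * v) n ⟨
      (v + i * 3 + k * v * n) % n            ≡⟨ cong (_% n) (shift i) ⟨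
      ((i + u * v) * 3) % n                  ≡⟨ toℕ-fromℕ< _ ⟨
      toℕ (((i + u * v) * 3) mod n)          ∎

lemma5 : (n : ℕ) → 3 < n → ¬ (3 ∣ n) →
    Σ (Circuit n n) (λ c → Primitive c × walkSum c ≡ 3 * n ×
      ((c' : Circuit n n) → Primitive c' → walkSum c' ≡ 3 * n → SameOrbit c c'))
lemma5 zero ()
lemma5 n@(suc _) _ 3∤n with 3-invertible-mod n 3∤n
... | u , k , 3u≡1+kn =
  arc3Circuit n ,
  arc3Circuit-primitive {u} {k} n 3u≡1+kn ,
  walkSum-arc3Circuit n ,
  λ c _ ws → arc3Circuit-unique {u} {k} n 3u≡1+kn c (walkSum≡3*l⇒arc≡a3 c ws)
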